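{- Let $\langle F,G,\mathbb F,\mathbb G,H_{grd},F_{exp},G_{exp},\theta\rangle$ be an interpolant lifting base, and let $\mathbb{FG}=\mathbb F\cup\mathbb G$. Let $\{t_1,\dots,t_n\}$ be the set of $\mathbb{FG}$-terms that have an $\mathbb{FG}$-terms-maximal occurrence in $H_{grd}$, ordered such that if $t_i$ is a strict subterm of $t_j$ then $i<j$. Let $v_1,\dots,v_n$ be fresh pairwise distinct variables, $\sigma=\{v_i\mapsto t_i\mid i\in\{1,\dots,n\}\}$, and for each $i$ let $Q_i=\exists$ if $t_i$ is an $\mathbb F$-term and $Q_i=\forall$ otherwise. Then $$F\models Q_1v_1\ldots Q_nv_n\,H_{grd}\sigma^{ -1}.$$
   Context: Formulas are first-order without equality, built from atoms, $\top,\bot,\lnot,\land,\lor,\forall,\exists$; polarity of a subformula occurrence is positive (negative) if it is under an even (odd) number of negations. $\mathrm{pred}(F)$ is the set of pairs $\langle p,pol\rangle$ such that an atom with predicate $p$ occurs in $F$ with polarity $pol\in\{+,-\}$. $\mathrm{fun}(E)$ is the set of function symbols (including constants) in $E$; $\mathrm{var}(E)$ the set of variables; $\mathrm{free}(F)$ the free variables; $\mathrm{voc}(F)=\mathrm{pred}(F)\cup\mathrm{fun}(F)$. A Craig-Lyndon interpolant of $F,G$ is a formula $H$ with $F\models H\models G$, $\mathrm{voc}(H)\subseteq\mathrm{voc}(F)\cap\mathrm{voc}(G)$, $\mathrm{free}(H)\subseteq\mathrm{free}(F)\cap\mathrm{free}(G)$. $\exists\mathbb F$, $\forall\mathbb G$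 denote second-order quantification over the function symbols in these sets. An $\mathbb S$-term is a term whose outermost function symbol is in $\mathbb S$. An occurrence of a member of a set $\mathcal T$ of terms in $E$ is $\mathcal T$-maximal if not within an occurrence of another member of $\mathcal T$. For injective $\sigma$, $E\sigma^{ -1}$ is $E$ with each $\mathrm{rng}(\sigma)$-maximal occurrence of $t\in\mathrm{rng}(\sigma)$ replaced by the variable mapped by $\sigma$ to $t$. An interpolant lifting base is a tuple $\langle F,G,\mathbb F,\mathbb G,H_{grd},F_{exp},G_{exp},\theta\rangle$ with $F,G$ first-order sentences, $\mathbb F,\mathbb G$ disjoint sets of function symbols, $H_{grd}$ ground, $F_{exp},G_{exp}$ quantifier-free, $\theta$ a ground substitution, such that: (1) $F\models\exists\mathbb F\,\forall U\,F_{exp}$, $U=\mathrm{var}(F_{exp})$; (1') $\forall\mathbb G\,\exists V\,G_{exp}\models G$, $V=\mathrm{var}(G_{exp})$; (2) $\mathrm{pred}(F_{exp})\subseteq\mathrm{pred}(F)$; (2') $\mathrm{pred}(G_{exp})\subseteq\mathrm{pred}(G)$; (3) $\mathrm{fun}(F_{exp})\subseteq(\mathrm{fun}(F)\cap\mathrm{fun}(G))\cup\mathbb F$; (3') $\mathrm{fun}(G_{exp})\subseteq(\mathrm{fun}(F)\cap\mathrm{fun}(G))\cup\mathbb G$; (4) $\mathrm{fun}(F)\cap\mathbb G=\emptyset$; (4') $\mathrm{fun}(G)\cap\mathbb F=\emptyset$; (5) $\mathrm{dom}(\theta)=\mathrm{var}(F_{exp})\cup\mathrm{var}(G_{exp})$;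 (6) $\mathrm{fun}(\mathrm{rng}(\theta))\subseteq\mathrm{fun}(F_{exp})\cup\mathrm{fun}(G_{exp})\cup\{c_0\}$, where $c_0$ is a constant in $\mathbb F\cup\mathbb G$; (7) $H_{grd}$ is a Craig-Lyndon interpolant of $F_{exp}\theta$ and $G_{exp}\theta$. -}

module Defs where

open import Level using (0ℓ)
open import Data.Nat as ℕ using (ℕ; zero; suc)
open import Data.Bool using (Bool; true; false; not; if_then_else_)
open import Data.Maybe using (Maybe; just; nothing)
open import Data.Product using (Σ; _×_; _,_; proj₁; proj₂; ∃)
open import Data.Product.Properties using (≡-dec)
open import Data.Sum using (_⊎_)
open import Data.Unit using (⊤)
open import Data.Empty using (⊥)
open import Data.List using (List; []; _∷_; _++_; map; filter; length; lookup; concatMap)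
open import Data.List.Membership.Propositional using (_∈_; _∉_)
open import Data.List.Relation.Unary.All using (All)
open import Data.List.Relation.Unary.Unique.Propositional using (Unique)
open import Data.Fin as Fin using (Fin)
open import Relation.Nullary using (Dec; yes; no; ¬_; does; ¬?)
open import Relation.Nullary.Decidable using (map′)
open import Relation.Binary.PropositionalEquality using (_≡_; refl; _≢_; cong; cong₂)
import Data.List.Membership.DecPropositional as DecMem

-- Syntax.  Variables, function names and predicate names are ℕ.
-- A function (predicate) *symbol* is a pair (name , arity); the arity of
-- an occurrence  fn f ts  is  length ts.

FSym : Set
FSym = ℕ × ℕ

PSym : Set
PSym = ℕ × ℕ

data Term : Set where
  var : ℕ → Term
  fn  : ℕ → List Term → Term

data Formula : Set where
  atom     : ℕ → List Term → Formula
  ⊤f ⊥f    : Formula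
  ¬f       : Formula → Formula
  _∧f_ _∨f_ : Formula → Formula → Formula
  ∀f ∃f    : ℕ → Formula → Formula

_≟ₛ_ : (x y : ℕ × ℕ) → Dec (x ≡ y)
_≟ₛ_ = ≡-dec ℕ._≟_ ℕ._≟_

_∈ₛ?_ : (x : ℕ × ℕ) → (xs : List (ℕ × ℕ)) → Dec (x ∈ xs)
_∈ₛ?_ = DecMem._∈?_ _≟ₛ_

private
  fn-inj₁ : ∀ {f g ts us} → fn f ts ≡ fn g us → f ≡ g
  fn-inj₁ refl = refl
  fn-inj₂ : ∀ {f g ts us} → fn f ts ≡ fn g us → ts ≡ us
  fn-inj₂ refl = refl
  var-inj : ∀ {x y} → var x ≡ var y → x ≡ y
  var-inj refl = refl
  ∷-inj₁ : ∀ {A : Set} {x y : A} {xs ys} → x ∷ xs ≡ y ∷ ys → x ≡ y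
  ∷-inj₁ refl = refl
  ∷-inj₂ : ∀ {A : Set} {x y : A} {xs ys} → x ∷ xs ≡ y ∷ ys → xs ≡ ys
  ∷-inj₂ refl = refl

mutual
  _≟T_ : (t u : Term) → Dec (t ≡ u)
  var x ≟T var y with x ℕ.≟ y
  ... | yes refl = yes refl
  ... | no x≢y = no (λ e → x≢y (var-inj e))
  var x ≟T fn g us = no (λ ())
  fn f ts ≟T var y = no (λ ())
  fn f ts ≟T fn g us with f ℕ.≟ g | ts ≟Ts us
  ... | yes refl | yes refl = yes refl
  ... | no f≢g | _ = no (λ e → f≢g (fn-inj₁ e))
  ... | yes _ | no ts≢us = no (λ e → ts≢us (fn-inj₂ e))

  _≟Ts_ : (ts us : List Term) → Dec (ts ≡ us)
  [] ≟Ts [] = yes refl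
  [] ≟Ts (_ ∷ _) = no (λ ())
  (_ ∷ _) ≟Ts [] = no (λ ())
  (t ∷ ts) ≟Ts (u ∷ us) with t ≟T u | ts ≟Ts us
  ... | yes refl | yes refl = yes refl
  ... | no t≢u | _ = no (λ e → t≢u (∷-inj₁ e))
  ... | yes _ | no ne = no (λ e → ne (∷-inj₂ e))

mutual
  varT : Term → List ℕ
  varT (var x) = x ∷ []
  varT (fn f ts) = varTs ts

  varTs : List Term → List ℕ
  varTs [] = []
  varTs (t ∷ ts) = varT t ++ varTs ts

mutual
  funT : Term → List FSym
  funT (var x) = []
  funT (fn f ts) = (f , length ts) ∷ funTs ts

  funTs : List Term → List FSym
  funTs [] = []
  funTs (t ∷ ts) = funT t ++ funTs ts

varF : Formula → List ℕ
varF (atom p ts) = varTs ts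
varF ⊤f = []
varF ⊥f = []
varF (¬f A) = varF A
varF (A ∧f B) = varF A ++ varF B
varF (A ∨f B) = varF A ++ varF B
varF (∀f x A) = x ∷ varF A
varF (∃f x A) = x ∷ varF A

free : Formula → List ℕ
free (atom p ts) = varTs ts
free ⊤f = []
free ⊥f = []
free (¬f A) = free A
free (A ∧f B) = free A ++ free B
free (A ∨f B) = free A ++ free B
free (∀f x A) = filter (λ y → ¬? (x ℕ.≟ y)) (free A)
free (∃f x A) = filter (λ y → ¬? (x ℕ.≟ y)) (free A)

fun : Formula → List FSym
fun (atom p ts) = funTs ts
fun ⊤f = []
fun ⊥f = []
fun (¬f A) = fun A
fun (A ∧f B) = fun A ++ fun B
fun (A ∨f B) = fun A ++ fun B
fun (∀f x A) = fun A
fun (∃f x A) = fun A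

-- polarity: true = positive (+), false = negative (-)
predPol : Bool → Formula → List (PSym × Bool)
predPol b (atom p ts) = ((p , length ts) , b) ∷ []
predPol b ⊤f = []
predPol b ⊥f = []
predPol b (¬f A) = predPol (not b) A
predPol b (A ∧f B) = predPol b A ++ predPol b B
predPol b (A ∨f B) = predPol b A ++ predPol b B
predPol b (∀f x A) = predPol b A
predPol b (∃f x A) = predPol b A

pred : Formula → List (PSym × Bool)
pred = predPol true

QuantifierFree : Formula → Set
QuantifierFree (atom p ts) = ⊤
QuantifierFree ⊤f = ⊤
QuantifierFree ⊥f = ⊤
QuantifierFree (¬f A) = QuantifierFree A
QuantifierFree (A ∧f B) = QuantifierFree A × QuantifierFree B
QuantifierFree (A ∨f B) = QuantifierFree A × QuantifierFree B
QuantifierFree (∀f x A) = ⊥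
QuantifierFree (∃f x A) = ⊥

Ground : Formula → Set
Ground A = varF A ≡ []

Sentence : Formula → Set
Sentence A = free A ≡ []

∀* : List ℕ → Formula → Formula
∀* [] A = A
∀* (x ∷ xs) A = ∀f x (∀* xs A)

∃* : List ℕ → Formula → Formula
∃* [] A = A
∃* (x ∷ xs) A = ∃f x (∃* xs A)

Subst : Set
Subst = List (ℕ × Term)

dom : Subst → List ℕ
dom = map proj₁

rng : Subst → List Term
rng = map proj₂

lookupVar : Subst → ℕ → Maybe Term
lookupVar [] x = nothing
lookupVar ((y , t) ∷ θ) x with x ℕ.≟ y
... | yes _ = just t
... | no _ = lookupVar θ x

mutual
  substT : Subst → Term → Term
  substT θ (var x) with lookupVar θ x
  ... | just t = t
  ... | nothing = var x
  substT θ (fn f ts) = fn f (substTs θ ts)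

  substTs : Subst → List Term → List Term
  substTs θ [] = []
  substTs θ (t ∷ ts) = substT θ t ∷ substTs θ ts

-- applied only to quantifier-free formulas in the statement
substF : Subst → Formula → Formula
substF θ (atom p ts) = atom p (substTs θ ts)
substF θ ⊤f = ⊤f
substF θ ⊥f = ⊥f
substF θ (¬f A) = ¬f (substF θ A)
substF θ (A ∧f B) = substF θ A ∧f substF θ B
substF θ (A ∨f B) = substF θ A ∨f substF θ B
substF θ (∀f x A) = ∀f x (substF θ A)
substF θ (∃f x A) = ∃f x (substF θ A)

-- E σ⁻¹ : replace each rng(σ)-maximal occurrence of t ∈ rng(σ) by the
-- variable mapped to t by σ
lookupTerm : Subst → Term → Maybe ℕ
lookupTerm [] u = nothing
lookupTerm ((v , t) ∷ σ) u with u ≟T t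
... | yes _ = just v
... | no _ = lookupTerm σ u

mutual
  invT : Subst → Term → Term
  invT σ u with lookupTerm σ u
  invT σ u | just v = var v
  invT σ (var x) | nothing = var x
  invT σ (fn f ts) | nothing = fn f (invTs σ ts)

  invTs : Subst → List Term → List Term
  invTs σ [] = []
  invTs σ (t ∷ ts) = invT σ t ∷ invTs σ ts

invF : Subst → Formula → Formula
invF σ (atom p ts) = atom p (invTs σ ts)
invF σ ⊤f = ⊤f
invF σ ⊥f = ⊥f
invF σ (¬f A) = ¬f (invF σ A)
invF σ (A ∧f B) = invF σ A ∧f invF σ B
invF σ (A ∨f B) = invF σ A ∨f invF σ B
invF σ (∀f x A) = ∀f x (invF σ A)
invF σ (∃f x A) = ∃f x (invF σ A)

IsTermOf : List FSym → Term → Set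
IsTermOf 𝕊 (var x) = ⊥
IsTermOf 𝕊 (fn f ts) = (f , length ts) ∈ 𝕊

isTermOf? : (𝕊 : List FSym) → (t : Term) → Dec (IsTermOf 𝕊 t)
isTermOf? 𝕊 (var x) = no (λ ())
isTermOf? 𝕊 (fn f ts) = (f , length ts) ∈ₛ? 𝕊

mutual
  maxT : List FSym → Term → List Term
  maxT 𝕊 (var x) = []
  maxT 𝕊 (fn f ts) with (f , length ts) ∈ₛ? 𝕊
  ... | yes _ = fn f ts ∷ []
  ... | no _ = maxTs 𝕊 ts

  maxTs : List FSym → List Term → List Term
  maxTs 𝕊 [] = []
  maxTs 𝕊 (t ∷ ts) = maxT 𝕊 t ++ maxTs 𝕊 ts

maxF : List FSym → Formula → List Term
maxF 𝕊 (atom p ts) = maxTs 𝕊 ts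
maxF 𝕊 ⊤f = []
maxF 𝕊 ⊥f = []
maxF 𝕊 (¬f A) = maxF 𝕊 A
maxF 𝕊 (A ∧f B) = maxF 𝕊 A ++ maxF 𝕊 B
maxF 𝕊 (A ∨f B) = maxF 𝕊 A ++ maxF 𝕊 B
maxF 𝕊 (∀f x A) = maxF 𝕊 A
maxF 𝕊 (∃f x A) = maxF 𝕊 A

data _⊏_ : Term → Term → Set where
  arg  : ∀ {s f ts} → s ∈ ts → s ⊏ fn f ts
  deep : ∀ {s u f ts} → u ∈ ts → s ⊏ u → s ⊏ fn f ts

prefix : List FSym → Subst → Formula → Formula
prefix 𝔽 [] A = A
prefix 𝔽 ((v , t) ∷ σ) A with isTermOf? 𝔽 t
... | yes _ = ∃f v (prefix 𝔽 σ A)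
... | no _ = ∀f v (prefix 𝔽 σ A)

record Structure : Set₁ where
  field
    D     : Set
    inhab : D
    fnI   : ℕ → List D → D      -- interpretation of (f , arity) via length
    prI   : ℕ → List D → Set

open Structure public

withFun : (M : Structure) → (ℕ → List (D M) → D M) → Structure
withFun M g = record M { fnI = g }

update : {A : Set} → (ℕ → A) → ℕ → A → ℕ → A
update ρ x d y with x ℕ.≟ y
... | yes _ = d
... | no _ = ρ y

mutual
  evalT : (M : Structure) → (ℕ → D M) → Term → D M
  evalT M ρ (var x) = ρ x
  evalT M ρ (fn f ts) = fnI M f (evalTs M ρ ts)

  evalTs : (M : Structure) → (ℕ → D M) → List Term → List (D M)
  evalTs M ρ [] = []
  evalTs M ρ (t ∷ ts) = evalT M ρ t ∷ evalTs M ρ ts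

⟦_⟧ : Formula → (M : Structure) → (ℕ → D M) → Set
⟦ atom p ts ⟧ M ρ = prI M p (evalTs M ρ ts)
⟦ ⊤f ⟧ M ρ = ⊤
⟦ ⊥f ⟧ M ρ = ⊥
⟦ ¬f A ⟧ M ρ = ¬ ⟦ A ⟧ M ρ
⟦ A ∧f B ⟧ M ρ = ⟦ A ⟧ M ρ × ⟦ B ⟧ M ρ
⟦ A ∨f B ⟧ M ρ = ⟦ A ⟧ M ρ ⊎ ⟦ B ⟧ M ρ
⟦ ∀f x A ⟧ M ρ = (d : D M) → ⟦ A ⟧ M (update ρ x d)
⟦ ∃f x A ⟧ M ρ = Σ (D M) (λ d → ⟦ A ⟧ M (update ρ x d))

_⊨_ : Formula → Formula → Set₁
A ⊨ B = (M : Structure) (ρ : ℕ → D M) → ⟦ A ⟧ M ρ → ⟦ B ⟧ M ρ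

AgreeOutside : List FSym → (M : Structure) → (ℕ → List (D M) → D M) → Set
AgreeOutside 𝕊 M g = ∀ f ds → (f , length ds) ∉ 𝕊 → g f ds ≡ fnI M f ds

-- A ⊨ ∃𝕊 B   (second-order ∃ over the function symbols in 𝕊)
_⊨∃SO_·_ : Formula → List FSym → Formula → Set₁
A ⊨∃SO 𝕊 · B = (M : Structure) (ρ : ℕ → D M) → ⟦ A ⟧ M ρ →
  Σ (ℕ → List (D M) → D M) (λ g → AgreeOutside 𝕊 M g × ⟦ B ⟧ (withFun M g) ρ)

-- ∀𝕊 A ⊨ B   (second-order ∀ over the function symbols in 𝕊)
∀SO_·_⊨_ : List FSym → Formula → Formula → Set₁
∀SO 𝕊 · A ⊨ B = (M : Structure) (ρ : ℕ → D M) →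
  ((g : ℕ → List (D M) → D M) → AgreeOutside 𝕊 M g → ⟦ A ⟧ (withFun M g) ρ) →
  ⟦ B ⟧ M ρ

record CraigLyndon (A B H : Formula) : Set₁ where
  field
    entailˡ : A ⊨ H
    entailʳ : H ⊨ B
    predSub : ∀ x → x ∈ pred H → x ∈ pred A × x ∈ pred B
    funSub  : ∀ x → x ∈ fun H → x ∈ fun A × x ∈ fun B
    freeSub : ∀ x → x ∈ free H → x ∈ free A × x ∈ free B

record LiftingBase (F G : Formula) (𝔽 𝔾 : List FSym)
                   (Hgrd Fexp Gexp : Formula) (θ : Subst) : Set₁ where
  field
    sentF    : Sentence F
    sentG    : Sentence G
    disjoint : ∀ s → s ∈ 𝔽 → s ∉ 𝔾
    groundH  : Ground Hgrd
    qfF      : QuantifierFree Fexp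
    qfG      : QuantifierFree Gexp
    θground  : All (λ t → varT t ≡ []) (rng θ)
    θfun     : Unique (dom θ)
    c1  : F ⊨∃SO 𝔽 · ∀* (varF Fexp) Fexp
    c1' : ∀SO 𝔾 · ∃* (varF Gexp) Gexp ⊨ G
    c2  : ∀ x → x ∈ pred Fexp → x ∈ pred F
    c2' : ∀ x → x ∈ pred Gexp → x ∈ pred G
    c3  : ∀ s → s ∈ fun Fexp → (s ∈ fun F × s ∈ fun G) ⊎ s ∈ 𝔽
    c3' : ∀ s → s ∈ fun Gexp → (s ∈ fun F × s ∈ fun G) ⊎ s ∈ 𝔾
    c4  : ∀ s → s ∈ fun F → s ∉ 𝔾
    c4' : ∀ s → s ∈ fun G → s ∉ 𝔽
    c5  : ∀ x → (x ∈ dom θ → x ∈ varF Fexp ⊎ x ∈ varF Gexp)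
              × (x ∈ varF Fexp ⊎ x ∈ varF Gexp → x ∈ dom θ)
    c₀     : FSym
    c₀const : proj₂ c₀ ≡ 0
    c₀mem  : c₀ ∈ 𝔽 ++ 𝔾
    c6  : ∀ s → s ∈ funTs (rng θ) → s ∈ fun Fexp ⊎ s ∈ fun Gexp ⊎ s ≡ c₀
    c7  : CraigLyndon (substF θ Fexp) (substF θ Gexp) Hgrd

module Submission where

open import Defs
open import Level using (0ℓ)
open import Axiom.ExcludedMiddle using (ExcludedMiddle)
open import Data.Nat as ℕ using (ℕ; suc; _+_; _≤_; s≤s; s<s⁻¹)
open import Data.Nat.Properties using (≤-trans; m≤m+n; m≤n+m; <-irrefl; <⇒≤; n≮0)
open import Data.Product using (∃-syntax; _×_; _,_; proj₁; proj₂)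
open import Data.Product.Function.NonDependent.Propositional using (_×-⇔_)
open import Data.Sum as Sum using (_⊎_; inj₁; inj₂; map₂; [_,_]′)
open import Data.Sum.Function.Propositional using (_⊎-⇔_)
open import Data.Unit using (tt)
open import Data.Empty using (⊥-elim)
open import Data.Maybe using (just; nothing)
open import Data.List using (List; []; _∷_; _++_; _∷ʳ_; length; lookup)
open import Data.List.Properties using (++-assoc; ++-identityʳ; ++-conicalˡ; ++-conicalʳ)
open import Data.List.Membership.Propositional using (_∈_; _∉_)
open import Data.List.Membership.Propositional.Properties using (∈-++⁺ˡ; ∈-++⁺ʳ; ∈-++⁻; ∈-map⁺)
open import Data.List.Relation.Unary.Any using (Any; here; there; index)
open import Data.List.Relation.Unary.Any.Properties using (lookup-index; ¬Any[])
open import Data.List.Relation.Unary.All as All using (All; []; _∷_)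
open import Data.List.Relation.Unary.All.Properties using (++⁻ˡ; ++⁻ʳ) renaming (++⁺ to All-++⁺)
open import Data.List.Relation.Unary.AllPairs as AllPairs using (AllPairs; []; _∷_)
open import Data.List.Relation.Unary.AllPairs.Properties using (map⁻)
open import Data.List.Relation.Unary.Unique.Propositional using (Unique)
open import Data.Fin as Fin using (Fin; _<_)
open import Function.Base using (_∘_)
open import Function.Bundles using (_⇔_; Equivalence)
open import Function.Construct.Identity using (⇔-id)
open import Function.Related.TypeIsomorphisms using (¬-cong-⇔)
open import Relation.Nullary using (yes; no; ¬_)
open import Relation.Binary.PropositionalEquality using (_≡_; refl; sym; trans; cong; cong₂; subst; _≢_; module ≡-Reasoning)

open Equivalence using (to)
open ≡-Reasoning

-- Fix a model M of F.  By (1) it expands, changing only 𝔽-symbols, to a model M⁺ of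
-- ∀U F_exp.  Interpret each existential vᵢ, where tᵢ = f(s₁,…,sₖ), as the value of
-- f(s₁σ⁻¹,…,sₖσ⁻¹) in M⁺; these arguments only mention variables introduced for strict
-- subterms of tᵢ, which precede vᵢ in the prefix.  Let T be the term structure in which
-- an atom holds iff its σ⁻¹-image holds in M⁺.  By the choice of the witnesses, every
-- 𝔾-free term u takes the value of (uθ)σ⁻¹ under the valuation x ↦ (xθ)σ⁻¹ of M⁺, so T
-- satisfies F_exp θ and hence the interpolant H_grd.  That is, H_grd σ⁻¹ holds in M⁺, and
-- also in M, since σ⁻¹ removes every 𝔽𝔾-symbol of H_grd.

mutual
  size : Term → ℕ
  size (var x) = 1
  size (fn f ts) = suc (sizes ts)

  sizes : List Term → ℕ
  sizes [] = 0
  sizes (t ∷ ts) = size t + sizes ts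

∈⇒size≤sizes : ∀ {s ts} → s ∈ ts → size s ≤ sizes ts
∈⇒size≤sizes {ts = t ∷ ts} (here refl) = m≤m+n (size t) (sizes ts)
∈⇒size≤sizes {ts = t ∷ ts} (there s∈ts) = ≤-trans (∈⇒size≤sizes s∈ts) (m≤n+m (sizes ts) (size t))

⊏⇒size< : ∀ {s t} → s ⊏ t → size s ℕ.< size t
⊏⇒size< (arg s∈ts) = s≤s (∈⇒size≤sizes s∈ts)
⊏⇒size< (deep u∈ts s⊏u) = s≤s (≤-trans (<⇒≤ (⊏⇒size< s⊏u)) (∈⇒size≤sizes u∈ts))

⊏-irrefl : ∀ {t} → ¬ (t ⊏ t)
⊏-irrefl t⊏t = <-irrefl refl (⊏⇒size< t⊏t)

length-substTs : ∀ θ ts → length (substTs θ ts) ≡ length ts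
length-substTs θ [] = refl
length-substTs θ (t ∷ ts) = cong suc (length-substTs θ ts)

length-invTs : ∀ σ ts → length (invTs σ ts) ≡ length ts
length-invTs σ [] = refl
length-invTs σ (t ∷ ts) = cong suc (length-invTs σ ts)

length-evalTs : ∀ M ρ ts → length (evalTs M ρ ts) ≡ length ts
length-evalTs M ρ [] = refl
length-evalTs M ρ (t ∷ ts) = cong suc (length-evalTs M ρ ts)

ground⇒quantifierFree : ∀ A → Ground A → QuantifierFree A
ground⇒quantifierFree (atom p ts) _ = tt
ground⇒quantifierFree ⊤f _ = tt
ground⇒quantifierFree ⊥f _ = tt
ground⇒quantifierFree (¬f A) g = ground⇒quantifierFree A g
ground⇒quantifierFree (A ∧f B) g =
  ground⇒quantifierFree A (++-conicalˡ (varF A) (varF B) g) , ground⇒quantifierFree B (++-conicalʳ (varF A) (varF B) g)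
ground⇒quantifierFree (A ∨f B) g =
  ground⇒quantifierFree A (++-conicalˡ (varF A) (varF B) g) , ground⇒quantifierFree B (++-conicalʳ (varF A) (varF B) g)
ground⇒quantifierFree (∀f x A) ()
ground⇒quantifierFree (∃f x A) ()

module _ (𝕊 : List FSym) where

  mutual
    maxT-isTermOf : ∀ u {t} → t ∈ maxT 𝕊 u → IsTermOf 𝕊 t
    maxT-isTermOf (fn f ts) t∈ with (f , length ts) ∈ₛ? 𝕊 | t∈
    ... | yes f∈𝕊 | here refl = f∈𝕊
    ... | no _    | t∈ts = maxTs-isTermOf ts t∈ts

    maxTs-isTermOf : ∀ us {t} → t ∈ maxTs 𝕊 us → IsTermOf 𝕊 t
    maxTs-isTermOf (u ∷ us) t∈ with ∈-++⁻ (maxT 𝕊 u) t∈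
    ... | inj₁ t∈u = maxT-isTermOf u t∈u
    ... | inj₂ t∈us = maxTs-isTermOf us t∈us

  maxF-isTermOf : ∀ A {t} → t ∈ maxF 𝕊 A → IsTermOf 𝕊 t
  maxF-isTermOf (atom p ts) t∈ = maxTs-isTermOf ts t∈
  maxF-isTermOf (¬f A) t∈ = maxF-isTermOf A t∈
  maxF-isTermOf (A ∧f B) t∈ with ∈-++⁻ (maxF 𝕊 A) t∈
  ... | inj₁ t∈A = maxF-isTermOf A t∈A
  ... | inj₂ t∈B = maxF-isTermOf B t∈B
  maxF-isTermOf (A ∨f B) t∈ with ∈-++⁻ (maxF 𝕊 A) t∈
  ... | inj₁ t∈A = maxF-isTermOf A t∈A
  ... | inj₂ t∈B = maxF-isTermOf B t∈B
  maxF-isTermOf (∀f y A) t∈ = maxF-isTermOf A t∈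
  maxF-isTermOf (∃f y A) t∈ = maxF-isTermOf A t∈

  mutual
    maxT-varT : ∀ u {t x} → t ∈ maxT 𝕊 u → x ∈ varT t → x ∈ varT u
    maxT-varT (fn f ts) t∈ x∈t with (f , length ts) ∈ₛ? 𝕊 | t∈
    ... | yes _ | here refl = x∈t
    ... | no _  | t∈ts = maxTs-varTs ts t∈ts x∈t

    maxTs-varTs : ∀ us {t x} → t ∈ maxTs 𝕊 us → x ∈ varT t → x ∈ varTs us
    maxTs-varTs (u ∷ us) t∈ x∈t with ∈-++⁻ (maxT 𝕊 u) t∈
    ... | inj₁ t∈u = ∈-++⁺ˡ (maxT-varT u t∈u x∈t)
    ... | inj₂ t∈us = ∈-++⁺ʳ (varT u) (maxTs-varTs us t∈us x∈t)

  maxF-varF : ∀ A {t x} → t ∈ maxF 𝕊 A → x ∈ varT t → x ∈ varF A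
  maxF-varF (atom p ts) t∈ x∈t = maxTs-varTs ts t∈ x∈t
  maxF-varF (¬f A) t∈ x∈t = maxF-varF A t∈ x∈t
  maxF-varF (A ∧f B) t∈ x∈t with ∈-++⁻ (maxF 𝕊 A) t∈
  ... | inj₁ t∈A = ∈-++⁺ˡ (maxF-varF A t∈A x∈t)
  ... | inj₂ t∈B = ∈-++⁺ʳ (varF A) (maxF-varF B t∈B x∈t)
  maxF-varF (A ∨f B) t∈ x∈t with ∈-++⁻ (maxF 𝕊 A) t∈
  ... | inj₁ t∈A = ∈-++⁺ˡ (maxF-varF A t∈A x∈t)
  ... | inj₂ t∈B = ∈-++⁺ʳ (varF A) (maxF-varF B t∈B x∈t)
  maxF-varF (∀f y A) t∈ x∈t = there (maxF-varF A t∈ x∈t)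
  maxF-varF (∃f y A) t∈ x∈t = there (maxF-varF A t∈ x∈t)

lookupTerm-sound : ∀ σ u {x} → lookupTerm σ u ≡ just x → (x , u) ∈ σ
lookupTerm-sound ((v , t) ∷ σ) u eq with u ≟T t | eq
... | yes refl | refl = here refl
... | no _     | eq′  = there (lookupTerm-sound σ u eq′)

lookupTerm-complete : ∀ σ {u} → u ∈ rng σ → lookupTerm σ u ≢ nothing
lookupTerm-complete ((v , t) ∷ σ) {u} u∈ with u ≟T t | u∈
... | yes _  | _          = λ ()
... | no u≢t | here u≡t   = ⊥-elim (u≢t u≡t)
... | no _   | there u∈σ = lookupTerm-complete σ u∈σ

_⊑_ : Term → Term → Set
s ⊑ t = s ≡ t ⊎ s ⊏ t

⊑-arg⇒⊏ : ∀ {s f ts} → Any (s ⊑_) ts → s ⊏ fn f ts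
⊑-arg⇒⊏ (here (inj₁ refl)) = arg (here refl)
⊑-arg⇒⊏ (here (inj₂ s⊏t)) = deep (here refl) s⊏t
⊑-arg⇒⊏ {f = f} (there s⊑ts) with ⊑-arg⇒⊏ {f = f} s⊑ts
... | arg s∈ts = arg (there s∈ts)
... | deep u∈ts s⊏u = deep (there u∈ts) s⊏u

mutual
  varT-invT : ∀ σ u {x} → x ∈ varT (invT σ u) → x ∈ varT u ⊎ ∃[ s ] ((x , s) ∈ σ × s ⊑ u)
  varT-invT σ u x∈ with lookupTerm σ u in eq | x∈
  ... | just v | here refl = inj₂ (u , lookupTerm-sound σ u eq , inj₁ refl)
  varT-invT σ (var y) x∈ | nothing | x∈y = inj₁ x∈y
  varT-invT σ (fn f ts) x∈ | nothing | x∈ts =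
    map₂ (λ (s , xs∈σ , s⊑ts) → s , xs∈σ , inj₂ (⊑-arg⇒⊏ s⊑ts)) (varTs-invTs σ ts x∈ts)

  varTs-invTs : ∀ σ ts {x} → x ∈ varTs (invTs σ ts) → x ∈ varTs ts ⊎ ∃[ s ] ((x , s) ∈ σ × Any (s ⊑_) ts)
  varTs-invTs σ (t ∷ ts) x∈ with ∈-++⁻ (varT (invT σ t)) x∈
  ... | inj₁ x∈t = Sum.map ∈-++⁺ˡ (λ (s , xs∈σ , s⊑t) → s , xs∈σ , here s⊑t) (varT-invT σ t x∈t)
  ... | inj₂ x∈ts =
    Sum.map (∈-++⁺ʳ (varT t)) (λ (s , xs∈σ , s⊑ts) → s , xs∈σ , there s⊑ts) (varTs-invTs σ ts x∈ts)

module _ {A : Set} {R : A → A → Set} where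

  AllPairs-++ : ∀ {xs ys x y} → AllPairs R (xs ++ ys) → x ∈ xs → y ∈ ys → R x y
  AllPairs-++ {_ ∷ xs} (Rx ∷ _) (here refl) y∈ys = All.lookup Rx (∈-++⁺ʳ xs y∈ys)
  AllPairs-++ {_ ∷ _} (_ ∷ Rxs) (there x∈xs) y∈ys = AllPairs-++ Rxs x∈xs y∈ys

  AllPairs-∈ : ∀ {xs x y} → AllPairs R xs → x ∈ xs → y ∈ xs → x ≡ y ⊎ R x y ⊎ R y x
  AllPairs-∈ _ (here refl) (here refl) = inj₁ refl
  AllPairs-∈ (Rx ∷ _) (here refl) (there y∈xs) = inj₂ (inj₁ (All.lookup Rx y∈xs))
  AllPairs-∈ (Rx ∷ _) (there x∈xs) (here refl) = inj₂ (inj₂ (All.lookup Rx x∈xs))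
  AllPairs-∈ (_ ∷ Rxs) (there x∈xs) (there y∈xs) = AllPairs-∈ Rxs x∈xs y∈xs

  ordered⇒AllPairs : ∀ xs → (∀ i j → R (lookup xs i) (lookup xs j) → i < j) →
                     AllPairs (λ x y → ¬ R y x) xs
  ordered⇒AllPairs [] _ = []
  ordered⇒AllPairs (x ∷ xs) ordered =
    All.tabulate (λ y∈xs Ryx →
      n≮0 (ordered (Fin.suc (index y∈xs)) Fin.zero (subst (λ y → R y x) (lookup-index y∈xs) Ryx)))
    ∷ ordered⇒AllPairs xs (λ i j Rij → s<s⁻¹ (ordered (Fin.suc i) (Fin.suc j) Rij))

≡⇒⇔ : ∀ {X Y : Set} → X ≡ Y → X ⇔ Y
≡⇒⇔ {X} refl = ⇔-id X

update-same : ∀ {A : Set} (ρ : ℕ → A) x d → update ρ x d x ≡ d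
update-same ρ x d with x ℕ.≟ x
... | yes _ = refl
... | no x≢x = ⊥-elim (x≢x refl)

update-other : ∀ {A : Set} (ρ : ℕ → A) x d {y} → x ≢ y → update ρ x d y ≡ ρ y
update-other ρ x d {y} x≢y with x ℕ.≟ y
... | yes x≡y = ⊥-elim (x≢y x≡y)
... | no _ = refl

module _ (M : Structure) {ρ ρ′ : ℕ → D M} where

  mutual
    evalT-cong : ∀ t → All (λ x → ρ x ≡ ρ′ x) (varT t) → evalT M ρ t ≡ evalT M ρ′ t
    evalT-cong (var x) (ρx≡ρ′x ∷ []) = ρx≡ρ′x
    evalT-cong (fn f ts) agree = cong (fnI M f) (evalTs-cong ts agree)

    evalTs-cong : ∀ ts → All (λ x → ρ x ≡ ρ′ x) (varTs ts) → evalTs M ρ ts ≡ evalTs M ρ′ ts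
    evalTs-cong [] _ = refl
    evalTs-cong (t ∷ ts) agree =
      cong₂ _∷_ (evalT-cong t (++⁻ˡ (varT t) agree)) (evalTs-cong ts (++⁻ʳ (varT t) agree))

data Parallel (R : List Term → List Term → Set) : Formula → Formula → Set where
  atom : ∀ {p ts us} → R ts us → Parallel R (atom p ts) (atom p us)
  ⊤f   : Parallel R ⊤f ⊤f
  ⊥f   : Parallel R ⊥f ⊥f
  ¬f   : ∀ {A B} → Parallel R A B → Parallel R (¬f A) (¬f B)
  _∧f_ : ∀ {A A′ B B′} → Parallel R A A′ → Parallel R B B′ → Parallel R (A ∧f B) (A′ ∧f B′)
  _∨f_ : ∀ {A A′ B B′} → Parallel R A A′ → Parallel R B B′ → Parallel R (A ∨f B) (A′ ∨f B′)

module _ {R : List Term → List Term → Set} (M N : Structure) (ρ : ℕ → D M) (η : ℕ → D N)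
         (atom⇔ : ∀ {p ts us} → R ts us → prI M p (evalTs M ρ ts) ⇔ prI N p (evalTs N η us)) where

  ⟦⟧-parallel : ∀ {A B} → Parallel R A B → ⟦ A ⟧ M ρ ⇔ ⟦ B ⟧ N η
  ⟦⟧-parallel (atom r) = atom⇔ r
  ⟦⟧-parallel ⊤f = ⇔-id _
  ⟦⟧-parallel ⊥f = ⇔-id _
  ⟦⟧-parallel (¬f A∥B) = ¬-cong-⇔ (⟦⟧-parallel A∥B)
  ⟦⟧-parallel (A∥A′ ∧f B∥B′) = ⟦⟧-parallel A∥A′ ×-⇔ ⟦⟧-parallel B∥B′
  ⟦⟧-parallel (A∥A′ ∨f B∥B′) = ⟦⟧-parallel A∥A′ ⊎-⇔ ⟦⟧-parallel B∥B′

parallel-refl : ∀ {P : ℕ → Set} A → QuantifierFree A → All P (varF A) →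
                Parallel (λ ts us → ts ≡ us × All P (varTs ts)) A A
parallel-refl (atom p ts) _ Pvars = atom (refl , Pvars)
parallel-refl ⊤f _ _ = ⊤f
parallel-refl ⊥f _ _ = ⊥f
parallel-refl (¬f A) qf Pvars = ¬f (parallel-refl A qf Pvars)
parallel-refl (A ∧f B) (qfA , qfB) Pvars =
  parallel-refl A qfA (++⁻ˡ (varF A) Pvars) ∧f parallel-refl B qfB (++⁻ʳ (varF A) Pvars)
parallel-refl (A ∨f B) (qfA , qfB) Pvars =
  parallel-refl A qfA (++⁻ˡ (varF A) Pvars) ∨f parallel-refl B qfB (++⁻ʳ (varF A) Pvars)

parallel-substF : ∀ θ {P : FSym → Set} A → QuantifierFree A → All P (fun A) →
                  Parallel (λ ts us → us ≡ substTs θ ts × All P (funTs ts)) A (substF θ A)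
parallel-substF θ (atom p ts) _ Pfuns = atom (refl , Pfuns)
parallel-substF θ ⊤f _ _ = ⊤f
parallel-substF θ ⊥f _ _ = ⊥f
parallel-substF θ (¬f A) qf Pfuns = ¬f (parallel-substF θ A qf Pfuns)
parallel-substF θ (A ∧f B) (qfA , qfB) Pfuns =
  parallel-substF θ A qfA (++⁻ˡ (fun A) Pfuns) ∧f parallel-substF θ B qfB (++⁻ʳ (fun A) Pfuns)
parallel-substF θ (A ∨f B) (qfA , qfB) Pfuns =
  parallel-substF θ A qfA (++⁻ˡ (fun A) Pfuns) ∨f parallel-substF θ B qfB (++⁻ʳ (fun A) Pfuns)

parallel-invF : ∀ σ 𝕊 {P : Term → Set} A → QuantifierFree A → All P (maxF 𝕊 A) →
                Parallel (λ ts us → us ≡ invTs σ ts × All P (maxTs 𝕊 ts)) A (invF σ A)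
parallel-invF σ 𝕊 (atom p ts) _ Pmax = atom (refl , Pmax)
parallel-invF σ 𝕊 ⊤f _ _ = ⊤f
parallel-invF σ 𝕊 ⊥f _ _ = ⊥f
parallel-invF σ 𝕊 (¬f A) qf Pmax = ¬f (parallel-invF σ 𝕊 A qf Pmax)
parallel-invF σ 𝕊 (A ∧f B) (qfA , qfB) Pmax =
  parallel-invF σ 𝕊 A qfA (++⁻ˡ (maxF 𝕊 A) Pmax) ∧f parallel-invF σ 𝕊 B qfB (++⁻ʳ (maxF 𝕊 A) Pmax)
parallel-invF σ 𝕊 (A ∨f B) (qfA , qfB) Pmax =
  parallel-invF σ 𝕊 A qfA (++⁻ˡ (maxF 𝕊 A) Pmax) ∨f parallel-invF σ 𝕊 B qfB (++⁻ʳ (maxF 𝕊 A) Pmax)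

⟦⟧-cong-qf : ∀ M A → QuantifierFree A → {ρ ρ′ : ℕ → D M} →
             All (λ x → ρ x ≡ ρ′ x) (varF A) → ⟦ A ⟧ M ρ → ⟦ A ⟧ M ρ′
⟦⟧-cong-qf M A qf agree =
  to (⟦⟧-parallel M M _ _ (λ { {p} {ts} (refl , agreeₜ) → ≡⇒⇔ (cong (prI M p) (evalTs-cong M ts agreeₜ)) })
                  (parallel-refl A qf agree))

∀*-elim : ∀ M A → QuantifierFree A → ∀ xs {ρ ρ′ : ℕ → D M} →
          All (λ y → y ∉ xs → ρ y ≡ ρ′ y) (varF A) → ⟦ ∀* xs A ⟧ M ρ → ⟦ A ⟧ M ρ′
∀*-elim M A qf [] agree = ⟦⟧-cong-qf M A qf (All.map (λ agreeᵧ → agreeᵧ (λ ())) agree)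
∀*-elim M A qf (x ∷ xs) {ρ} {ρ′} agree ⊨∀ = ∀*-elim M A qf xs (All.map agree′ agree) (⊨∀ (ρ′ x))
  where
    agree′ : ∀ {y} → (y ∉ x ∷ xs → ρ y ≡ ρ′ y) → y ∉ xs → update ρ x (ρ′ x) y ≡ ρ′ y
    agree′ {y} agreeᵧ y∉xs with x ℕ.≟ y
    ... | yes refl = refl
    ... | no x≢y = agreeᵧ λ { (here y≡x) → x≢y (sym y≡x) ; (there y∈xs) → y∉xs y∈xs }

agreeOutside-weaken : ∀ {𝕊 𝕊′ M g} → (∀ {s} → s ∈ 𝕊 → s ∈ 𝕊′) → AgreeOutside 𝕊 M g → AgreeOutside 𝕊′ M g
agreeOutside-weaken 𝕊⊆𝕊′ agree f ds f∉𝕊′ = agree f ds (f∉𝕊′ ∘ 𝕊⊆𝕊′)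

-- σ⁻¹ only leaves 𝕊-symbols inside replaced terms, so it cannot see a change of them.
module _ (M : Structure) (g : ℕ → List (D M) → D M) (𝕊 : List FSym) (σ : Subst)
         (agree : AgreeOutside 𝕊 M g) (ρ : ℕ → D M) where

  mutual
    evalT-invT-withFun : ∀ u → All (_∈ rng σ) (maxT 𝕊 u) →
                         evalT (withFun M g) ρ (invT σ u) ≡ evalT M ρ (invT σ u)
    evalT-invT-withFun u covered with lookupTerm σ u in eq
    ... | just v = refl
    evalT-invT-withFun (var x) covered | nothing = refl
    evalT-invT-withFun (fn f ts) covered | nothing with (f , length ts) ∈ₛ? 𝕊 | covered
    ... | yes _ | fts∈σ ∷ [] = ⊥-elim (lookupTerm-complete σ fts∈σ eq)
    ... | no f∉𝕊 | coveredₜₛ =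
      trans (cong (g f) (evalTs-invTs-withFun ts coveredₜₛ)) (agree f _ (f∉𝕊 ∘ subst (λ n → (f , n) ∈ 𝕊) arity))
      where
        arity : length (evalTs M ρ (invTs σ ts)) ≡ length ts
        arity = trans (length-evalTs M ρ (invTs σ ts)) (length-invTs σ ts)

    evalTs-invTs-withFun : ∀ us → All (_∈ rng σ) (maxTs 𝕊 us) →
                           evalTs (withFun M g) ρ (invTs σ us) ≡ evalTs M ρ (invTs σ us)
    evalTs-invTs-withFun [] _ = refl
    evalTs-invTs-withFun (u ∷ us) covered =
      cong₂ _∷_ (evalT-invT-withFun u (++⁻ˡ (maxT 𝕊 u) covered)) (evalTs-invTs-withFun us (++⁻ʳ (maxT 𝕊 u) covered))

herbrand : (ℕ → List Term → Set) → Structure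
herbrand P = record { D = Term ; inhab = var 0 ; fnI = fn ; prI = P }

module _ (P : ℕ → List Term → Set) where

  mutual
    evalT-herbrand : ∀ t → evalT (herbrand P) var t ≡ t
    evalT-herbrand (var x) = refl
    evalT-herbrand (fn f ts) = cong (fn f) (evalTs-herbrand ts)

    evalTs-herbrand : ∀ ts → evalTs (herbrand P) var ts ≡ ts
    evalTs-herbrand [] = refl
    evalTs-herbrand (t ∷ ts) = cong₂ _∷_ (evalT-herbrand t) (evalTs-herbrand ts)

-- Skolem witnesses along the quantifier prefix

module Skolemisation (M : Structure) (g : ℕ → List (D M) → D M) (𝔽 : List FSym) (σ : Subst) where

  M⁺ : Structure
  M⁺ = withFun M g

  skolemValue : (ℕ → D M) → Term → D M
  skolemValue ρ (var x) = ρ x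
  skolemValue ρ (fn f args) = fnI M⁺ f (evalTs M⁺ ρ (invTs σ args))

  Witnessed : (ℕ → D M) → ℕ × Term → Set
  Witnessed ρ (w , t) = IsTermOf 𝔽 t → ρ w ≡ skolemValue ρ t

  Precedes : ℕ × Term → ℕ × Term → Set
  Precedes (w , u) (v , t) = w ≢ v × ¬ (t ⊏ u)

  module _ (ground : ∀ {t x} → t ∈ rng σ → x ∉ varT t) (precedes : AllPairs Precedes σ) where

    functional : ∀ {v s t} → (v , s) ∈ σ → (v , t) ∈ σ → s ≡ t
    functional vs∈σ vt∈σ with AllPairs-∈ precedes vs∈σ vt∈σ
    ... | inj₁ refl = refl
    ... | inj₂ (inj₁ (v≢v , _)) = ⊥-elim (v≢v refl)
    ... | inj₂ (inj₂ (v≢v , _)) = ⊥-elim (v≢v refl)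

    -- v can occur in uσ⁻¹ only in place of an occurrence of t inside u.
    skolemValue-update : ∀ {v t u} ρ d → (v , t) ∈ σ → u ∈ rng σ → ¬ (t ⊏ u) →
                         skolemValue (update ρ v d) u ≡ skolemValue ρ u
    skolemValue-update {u = var x} ρ d _ u∈σ _ = ⊥-elim (ground u∈σ (here refl))
    skolemValue-update {v} {t} {fn f args} ρ d vt∈σ u∈σ t⋢u =
      cong (fnI M⁺ f) (evalTs-cong M⁺ (invTs σ args) (All.tabulate (update-other ρ v d ∘ v∉)))
      where
        v∉ : ∀ {x} → x ∈ varTs (invTs σ args) → v ≢ x
        v∉ x∈ refl with varTs-invTs σ args x∈
        ... | inj₁ v∈args = ground u∈σ v∈args
        ... | inj₂ (s , vs∈σ , s⊑args) = t⋢u (subst (_⊏ fn f args) (functional vs∈σ vt∈σ) (⊑-arg⇒⊏ s⊑args))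

    module _ {π v t τ} (σ≡ : σ ≡ π ++ (v , t) ∷ τ) where

      next∈σ : (v , t) ∈ σ
      next∈σ = subst ((v , t) ∈_) (sym σ≡) (∈-++⁺ʳ π (here refl))

      witnessed-extend : ∀ ρ d → All (Witnessed ρ) π → Witnessed (update ρ v d) (v , t) →
                         All (Witnessed (update ρ v d)) (π ∷ʳ (v , t))
      witnessed-extend ρ d wπ wv = All-++⁺ (All.tabulate (λ e∈π → preserve e∈π (All.lookup wπ e∈π))) (wv ∷ [])
        where
          preserve : ∀ {w u} → (w , u) ∈ π → Witnessed ρ (w , u) → Witnessed (update ρ v d) (w , u)
          preserve {w} {u} wu∈π wu u∈𝔽 =
            trans (update-other ρ v d (w≢v ∘ sym))
              (trans (wu u∈𝔽) (sym (skolemValue-update ρ d next∈σ (∈-map⁺ proj₂ wu∈σ) t⋢u)))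
            where
              wu∈σ : (w , u) ∈ σ
              wu∈σ = subst ((w , u) ∈_) (sym σ≡) (∈-++⁺ˡ wu∈π)
              wu≺vt : Precedes (w , u) (v , t)
              wu≺vt = AllPairs-++ (subst (AllPairs Precedes) σ≡ precedes) wu∈π (here refl)
              w≢v : w ≢ v
              w≢v = proj₁ wu≺vt
              t⋢u : ¬ (t ⊏ u)
              t⋢u = proj₂ wu≺vt

    prefix-intro : ∀ B → (∀ ρ → All (Witnessed ρ) σ → ⟦ B ⟧ M ρ) → ∀ ρ → ⟦ prefix 𝔽 σ B ⟧ M ρ
    prefix-intro B final ρ = walk σ [] refl ρ []
      where
        walk : ∀ τ π → σ ≡ π ++ τ → ∀ ρ → All (Witnessed ρ) π → ⟦ prefix 𝔽 τ B ⟧ M ρ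
        walk [] π σ≡ ρ wπ = final ρ (subst (All (Witnessed ρ)) (sym (trans σ≡ (++-identityʳ π))) wπ)
        walk ((v , t) ∷ τ) π σ≡ ρ wπ with isTermOf? 𝔽 t
        ... | yes _ = d , walk τ (π ∷ʳ (v , t)) (trans σ≡ (sym (++-assoc π _ τ))) _ (witnessed-extend σ≡ ρ d wπ chosen)
          where
            d : D M
            d = skolemValue ρ t
            chosen : Witnessed (update ρ v d) (v , t)
            chosen _ = trans (update-same ρ v d)
                             (sym (skolemValue-update ρ d (next∈σ σ≡) (∈-map⁺ proj₂ (next∈σ σ≡)) ⊏-irrefl))
        ... | no t∉𝔽 = λ d → walk τ (π ∷ʳ (v , t)) (trans σ≡ (sym (++-assoc π _ τ))) _
                                   (witnessed-extend σ≡ ρ d wπ (⊥-elim ∘ t∉𝔽))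

  termModel : (ℕ → D M) → Structure
  termModel ρ = herbrand (λ p ts → prI M p (evalTs M⁺ ρ (invTs σ ts)))

  termModel-invF : ∀ 𝕊 → AgreeOutside 𝕊 M g → ∀ ρ A → QuantifierFree A → All (_∈ rng σ) (maxF 𝕊 A) →
                   ⟦ A ⟧ (termModel ρ) var ⇔ ⟦ invF σ A ⟧ M ρ
  termModel-invF 𝕊 agree ρ A qf covered =
    ⟦⟧-parallel (termModel ρ) M var ρ atom⇔ (parallel-invF σ 𝕊 A qf covered)
    where
      atom⇔ : ∀ {p ts us} → us ≡ invTs σ ts × All (_∈ rng σ) (maxTs 𝕊 ts) →
              prI M p (evalTs M⁺ ρ (invTs σ (evalTs (termModel ρ) var ts))) ⇔ prI M p (evalTs M ρ us)
      atom⇔ {p} {ts} (refl , coveredₜₛ) = ≡⇒⇔ (cong (prI M p) (begin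
        evalTs M⁺ ρ (invTs σ (evalTs (termModel ρ) var ts))  ≡⟨ cong (evalTs M⁺ ρ ∘ invTs σ) (evalTs-herbrand _ ts) ⟩
        evalTs M⁺ ρ (invTs σ ts)                              ≡⟨ evalTs-invTs-withFun M g 𝕊 σ agree ρ ts coveredₜₛ ⟩
        evalTs M ρ (invTs σ ts)                               ∎))

  module _ (θ : Subst) (𝔾 : List FSym) (ρ : ℕ → D M) (witnessed : All (Witnessed ρ) σ)
           (typed : ∀ {t} → t ∈ rng σ → IsTermOf (𝔽 ++ 𝔾) t) where

    ρθσ⁻¹ : ℕ → D M
    ρθσ⁻¹ x = evalT M⁺ ρ (invT σ (substT θ (var x)))

    mutual
      evalT-invT∘substT : ∀ u → All (_∉ 𝔾) (funT u) → evalT M⁺ ρθσ⁻¹ u ≡ evalT M⁺ ρ (invT σ (substT θ u))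
      evalT-invT∘substT (var x) _ = refl
      evalT-invT∘substT (fn f us) (f∉𝔾 ∷ us∉𝔾) with lookupTerm σ (fn f (substTs θ us)) in eq
      ... | nothing = cong (fnI M⁺ f) (evalTs-invTs∘substTs us us∉𝔾)
      ... | just v = trans (cong (fnI M⁺ f) (evalTs-invTs∘substTs us us∉𝔾)) (sym (All.lookup witnessed vt∈σ f∈𝔽))
        where
          vt∈σ : (v , fn f (substTs θ us)) ∈ σ
          vt∈σ = lookupTerm-sound σ _ eq
          f∈𝔽 : (f , length (substTs θ us)) ∈ 𝔽
          f∈𝔽 with ∈-++⁻ 𝔽 (typed (∈-map⁺ proj₂ vt∈σ))
          ... | inj₁ f∈𝔽 = f∈𝔽
          ... | inj₂ f∈𝔾 = ⊥-elim (f∉𝔾 (subst (λ n → (f , n) ∈ 𝔾) (length-substTs θ us) f∈𝔾))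

      evalTs-invTs∘substTs : ∀ us → All (_∉ 𝔾) (funTs us) →
                             evalTs M⁺ ρθσ⁻¹ us ≡ evalTs M⁺ ρ (invTs σ (substTs θ us))
      evalTs-invTs∘substTs [] _ = refl
      evalTs-invTs∘substTs (u ∷ us) us∉𝔾 =
        cong₂ _∷_ (evalT-invT∘substT u (++⁻ˡ (funT u) us∉𝔾)) (evalTs-invTs∘substTs us (++⁻ʳ (funT u) us∉𝔾))

    substF-termModel : ∀ A → QuantifierFree A → All (_∉ 𝔾) (fun A) →
                       ⟦ A ⟧ M⁺ ρθσ⁻¹ ⇔ ⟦ substF θ A ⟧ (termModel ρ) var
    substF-termModel A qf A∉𝔾 = ⟦⟧-parallel M⁺ (termModel ρ) ρθσ⁻¹ var atom⇔ (parallel-substF θ A qf A∉𝔾)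
      where
        atom⇔ : ∀ {p ts us} → us ≡ substTs θ ts × All (_∉ 𝔾) (funTs ts) →
                prI M p (evalTs M⁺ ρθσ⁻¹ ts) ⇔ prI M p (evalTs M⁺ ρ (invTs σ (evalTs (termModel ρ) var us)))
        atom⇔ {p} {ts} (refl , ts∉𝔾) = ≡⇒⇔ (cong (prI M p) (begin
          evalTs M⁺ ρθσ⁻¹ ts                                                 ≡⟨ evalTs-invTs∘substTs ts ts∉𝔾 ⟩
          evalTs M⁺ ρ (invTs σ (substTs θ ts))                               ≡⟨ cong (evalTs M⁺ ρ ∘ invTs σ) (evalTs-herbrand _ (substTs θ ts)) ⟨
          evalTs M⁺ ρ (invTs σ (evalTs (termModel ρ) var (substTs θ ts)))  ∎))

lemma2 : ExcludedMiddle 0ℓ →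
    (F G : Formula) (𝔽 𝔾 : List FSym) (Hgrd Fexp Gexp : Formula) (θ : Subst) →
    LiftingBase F G 𝔽 𝔾 Hgrd Fexp Gexp θ →
    (σ : Subst) →
    -- rng σ = {t₁,…,tₙ}: the 𝔽𝔾-terms with an 𝔽𝔾-terms-maximal occurrence in H_grd
    Unique (rng σ) →
    (∀ t → (t ∈ rng σ → t ∈ maxF (𝔽 ++ 𝔾) Hgrd) × (t ∈ maxF (𝔽 ++ 𝔾) Hgrd → t ∈ rng σ)) →
    -- ordering: tᵢ strict subterm of tⱼ implies i < j
    (∀ (i j : Fin (length (rng σ))) → lookup (rng σ) i ⊏ lookup (rng σ) j → i < j) →
    -- v₁,…,vₙ pairwise distinct and fresh
    Unique (dom σ) →
    All (λ v → v ∉ varF F × v ∉ varF G × v ∉ varF Fexp × v ∉ varF Gexp × v ∉ varF Hgrd) (dom σ) →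
    F ⊨ prefix 𝔽 σ (invF σ Hgrd)
lemma2 _ F G 𝔽 𝔾 Hgrd Fexp Gexp θ base σ _ cover order distinct _ M ρ ⊨F with LiftingBase.c1 base M ρ ⊨F
... | g , agree , ⊨∀Fexp = prefix-intro ground precedes (invF σ Hgrd) holds ρ
  where
    open LiftingBase base
    open Skolemisation M g 𝔽 σ

    ground : ∀ {t x} → t ∈ rng σ → x ∉ varT t
    ground {t} t∈σ x∈t = ¬Any[] (subst (_ ∈_) groundH (maxF-varF (𝔽 ++ 𝔾) Hgrd (proj₁ (cover t) t∈σ) x∈t))

    precedes : AllPairs Precedes σ
    precedes = AllPairs.zip (map⁻ distinct , map⁻ (ordered⇒AllPairs (rng σ) order))

    typed : ∀ {t} → t ∈ rng σ → IsTermOf (𝔽 ++ 𝔾) t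
    typed {t} t∈σ = maxF-isTermOf (𝔽 ++ 𝔾) Hgrd (proj₁ (cover t) t∈σ)

    Fexp∉𝔾 : All (_∉ 𝔾) (fun Fexp)
    Fexp∉𝔾 = All.tabulate (λ {s} s∈ → [ c4 s ∘ proj₁ , disjoint s ]′ (c3 s s∈))

    holds : ∀ ρ′ → All (Witnessed ρ′) σ → ⟦ invF σ Hgrd ⟧ M ρ′
    holds ρ′ witnessed =
      to (termModel-invF (𝔽 ++ 𝔾) (agreeOutside-weaken {M = M} {g} ∈-++⁺ˡ agree) ρ′ Hgrd
                         (ground⇒quantifierFree Hgrd groundH) (All.tabulate (proj₂ (cover _))))
         (CraigLyndon.entailˡ c7 (termModel ρ′) var Fexpθ-holds)
      where
        Fexp-holds : ⟦ Fexp ⟧ M⁺ (ρθσ⁻¹ θ 𝔾 ρ′ witnessed typed)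
        Fexp-holds = ∀*-elim M⁺ Fexp qfF (varF Fexp) (All.tabulate (λ x∈ x∉ → ⊥-elim (x∉ x∈))) ⊨∀Fexp

        Fexpθ-holds : ⟦ substF θ Fexp ⟧ (termModel ρ′) var
        Fexpθ-holds = to (substF-termModel θ 𝔾 ρ′ witnessed typed Fexp qfF Fexp∉𝔾) Fexp-holds
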